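{- Let $D=\{\mathbf{v}_1,\dots,\mathbf{v}_m\}$ be a $\mathrm{DD}(m)$ and $k$ a positive integer, and suppose $D$ is used in the key predistribution scheme described below. Then the $k$-hop coverage of the scheme is equal to $C_k(D)$.
   Context: A $\mathrm{DD}(m)$ is a set of $m$ points of $\mathbb{Z}^2$ whose difference vectors $\mathbf{v}_i-\mathbf{v}_j$ ($i\ne j$) are all distinct. $C_k(D)$ is the number of non-zero vectors of the form $\sum_{i=1}^{\ell}(\mathbf{v}_{\alpha_i}-\mathbf{v}_{\beta_i})$ with $\alpha_i\ne\beta_i$ and $0\le\ell\le k$. The scheme: nodes are located at, and labelled by, the points of $\mathbb{Z}^2$; for every shift $\mathbf{u}\in\mathbb{Z}^2$ a key $k_\mathbf{u}$ is generated and assigned to the nodes $\mathbf{u}+\mathbf{v}_i$, $i=1,\dots,m$. Two nodes are joined by a one-hop path if they share a key; an $\ell$-hop path from $A$ to $B$ is a sequence $A=C_0,C_1,\dots,C_\ell=B$ of nodes with a one-hop path between each consecutive pair. The $k$-hop coverage of the scheme is the number of nodes (other than a given node $\mathbf{x}$) that can be reached from $\mathbf{x}$ by an $\ell$-hop path for some $1\le\ell\le k$ (this is independent of $\mathbf{x}$). -}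

module Defs where

open import Data.Nat using (ℕ; zero; suc; _≤_)
open import Data.Integer as ℤ using (ℤ)
open import Data.Fin using (Fin)
open import Data.Product using (_×_; _,_; Σ; ∃; ∃-syntax; proj₁; proj₂)
open import Data.List using (List; []; _∷_; length)
open import Data.List.Relation.Unary.All using (All)
open import Data.List.Relation.Unary.Unique.Propositional using (Unique)
open import Data.List.Membership.Propositional using (_∈_)
open import Relation.Binary.PropositionalEquality using (_≡_; _≢_)
open import Function.Bundles using (_⇔_)

Point : Set
Point = ℤ × ℤ

0ᵖ : Point
0ᵖ = (ℤ.+ 0 , ℤ.+ 0)

_⊕_ : Point → Point → Point
(a , b) ⊕ (c , d) = (a ℤ.+ c , b ℤ.+ d)

_⊖_ : Point → Point → Point
(a , b) ⊖ (c , d) = (a ℤ.- c , b ℤ.- d)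

IsDD : {m : ℕ} → (Fin m → Point) → Set
IsDD {m} v = ∀ (i j i' j' : Fin m) → i ≢ j → i' ≢ j' →
  (v i ⊖ v j) ≡ (v i' ⊖ v j') → (i ≡ i') × (j ≡ j')

diffSum : {m : ℕ} → (Fin m → Point) → List (Fin m × Fin m) → Point
diffSum v [] = 0ᵖ
diffSum v ((α , β) ∷ ps) = (v α ⊖ v β) ⊕ diffSum v ps

InCk : {m : ℕ} → (Fin m → Point) → ℕ → Point → Set
InCk {m} v k w = (w ≢ 0ᵖ) × (Σ (List (Fin m × Fin m)) λ ps →
  (length ps ≤ k) × All (λ p → proj₁ p ≢ proj₂ p) ps
  × (w ≡ diffSum v ps))

-- Key scheme: key k_u is held by nodes u + vᵢ. Two (distinct) nodes are joined
-- by a one-hop path iff they share a key.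
OneHop : {m : ℕ} → (Fin m → Point) → Point → Point → Set
OneHop {m} v A B = (A ≢ B) × (∃[ u ] ∃[ i ] ∃[ j ] ((A ≡ u ⊕ v i) × (B ≡ u ⊕ v j)))

data Path {m : ℕ} (v : Fin m → Point) : ℕ → Point → Point → Set where
  here : ∀ {A} → Path v zero A A
  step : ∀ {ℓ A C B} → OneHop v A C → Path v ℓ C B → Path v (suc ℓ) A B

Covered : {m : ℕ} → (Fin m → Point) → ℕ → Point → Point → Set
Covered v k x B = (B ≢ x) × (∃[ ℓ ] ((1 ≤ ℓ) × (ℓ ≤ k) × Path v ℓ x B))

HasSize : (Point → Set) → ℕ → Set
HasSize P n = Σ (List Point) λ xs → (length xs ≡ n) × Unique xs × (∀ y → P y ⇔ (y ∈ xs))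

module Submission where

-- Key k_u joins u + v_j to u + v_i, so a hop moves a node by a difference
-- v_i − v_j with i ≠ j, and conversely every such difference is the move of
-- some hop (through the key k_{A − v_j}), because the points of D are distinct.
-- Hence the nodes reachable from x in 1 … k hops are exactly the points x + w
-- with w a non-zero sum of at most k differences: a translate of the set
-- counted by C_k(D). That set is finite, being listed by all such sums.

open import Defs
open import Data.Nat using (ℕ; _≤_; zero; suc; z≤n; s≤s)
open import Data.Fin as F using (Fin)
import Data.Integer.Properties as ℤ
open import Data.Integer.Solver using (module +-*-Solver)
open import Data.Product using (_×_; ∃-syntax; ∃₂; _,_; proj₁; proj₂)
open import Data.Product.Properties using (≡-dec)
open import Data.List
  using (List; []; _∷_; length; map; filter; allFin; deduplicate;
         cartesianProduct; cartesianProductWith)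
open import Data.List.Properties using (length-map)
open import Data.List.Relation.Unary.All using (All; []; _∷_)
open import Data.List.Relation.Unary.Any using (here; there)
open import Data.List.Membership.Propositional using (_∈_)
open import Data.List.Membership.Propositional.Properties
  using (∈-map⁺; ∈-map⁻; ∈-filter⁺; ∈-filter⁻; ∈-allFin; ∈-cartesianProduct⁺;
         ∈-cartesianProductWith⁺; ∈-cartesianProductWith⁻; deduplicate-∈⇔)
open import Data.List.Relation.Unary.Unique.Propositional.Properties using (map⁺)
open import Data.List.Relation.Unary.Unique.DecPropositional.Properties using (deduplicate-!)
open import Data.Empty using (⊥-elim)
open import Function using (_∘_)
open import Function.Bundles using (_⇔_; mk⇔)
open import Function.Construct.Composition using (_⇔-∘_)
open import Function.Definitions using (Injective)
open import Relation.Binary.Definitions using (DecidableEquality)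
open import Relation.Binary.PropositionalEquality
open import Relation.Nullary using (Dec; yes; no; ¬?)

open +-*-Solver
open ≡-Reasoning

_≟ᵖ_ : DecidableEquality Point
_≟ᵖ_ = ≡-dec ℤ._≟_ ℤ._≟_

⊕-assoc : ∀ x y z → (x ⊕ y) ⊕ z ≡ x ⊕ (y ⊕ z)
⊕-assoc (a , b) (c , d) (e , f) = cong₂ _,_ (ℤ.+-assoc a c e) (ℤ.+-assoc b d f)

⊕-identityʳ : ∀ x → x ⊕ 0ᵖ ≡ x
⊕-identityʳ (a , b) = cong₂ _,_ (ℤ.+-identityʳ a) (ℤ.+-identityʳ b)

x⊖x≡0ᵖ : ∀ x → x ⊖ x ≡ 0ᵖ
x⊖x≡0ᵖ (a , b) = cong₂ _,_ (ℤ.+-inverseʳ a) (ℤ.+-inverseʳ b)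

x⊕[y⊖x]≡y : ∀ x y → x ⊕ (y ⊖ x) ≡ y
x⊕[y⊖x]≡y (a , b) (c , d) = cong₂ _,_ (law a c) (law b d)
  where law = solve 2 (λ a c → a :+ (c :- a) := c) refl

x⊕y⊖x≡y : ∀ x y → (x ⊕ y) ⊖ x ≡ y
x⊕y⊖x≡y (a , b) (c , d) = cong₂ _,_ (law a c) (law b d)
  where law = solve 2 (λ a c → (a :+ c) :- a := c) refl

[x⊖y]⊕y≡x : ∀ x y → (x ⊖ y) ⊕ y ≡ x
[x⊖y]⊕y≡x (a , b) (c , d) = cong₂ _,_ (law a c) (law b d)
  where law = solve 2 (λ a c → (a :- c) :+ c := a) refl

[x⊖y]⊕z≡x⊕[z⊖y] : ∀ x y z → (x ⊖ y) ⊕ z ≡ x ⊕ (z ⊖ y)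
[x⊖y]⊕z≡x⊕[z⊖y] (a , b) (c , d) (e , f) = cong₂ _,_ (law a c e) (law b d f)
  where law = solve 3 (λ a c e → (a :- c) :+ e := a :+ (e :- c)) refl

⊕-cancelˡ : ∀ x {y z} → x ⊕ y ≡ x ⊕ z → y ≡ z
⊕-cancelˡ x {y} {z} eq = begin
  y              ≡⟨ x⊕y⊖x≡y x y ⟨
  (x ⊕ y) ⊖ x    ≡⟨ cong (_⊖ x) eq ⟩
  (x ⊕ z) ⊖ x    ≡⟨ x⊕y⊖x≡y x z ⟩
  z              ∎

x⊖y≡0ᵖ⇒x≡y : ∀ x y → x ⊖ y ≡ 0ᵖ → x ≡ y
x⊖y≡0ᵖ⇒x≡y x y eq = begin
  x              ≡⟨ x⊕[y⊖x]≡y y x ⟨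
  y ⊕ (x ⊖ y)    ≡⟨ cong (y ⊕_) eq ⟩
  y ⊕ 0ᵖ         ≡⟨ ⊕-identityʳ y ⟩
  y              ∎

HasSize-resp-⇔ : ∀ {P Q : Point → Set} {n} → (∀ y → P y ⇔ Q y) → HasSize Q n → HasSize P n
HasSize-resp-⇔ P⇔Q (xs , len , unique , Q⇔∈) = xs , len , unique , λ y → Q⇔∈ y ⇔-∘ P⇔Q y

HasSize-translate : ∀ {P : Point → Set} {n} x → HasSize P n → HasSize (λ y → P (y ⊖ x)) n
HasSize-translate {P} x (xs , len , unique , P⇔∈) =
  map (x ⊕_) xs , trans (length-map (x ⊕_) xs) len , map⁺ (⊕-cancelˡ x) unique ,
  λ y → ∈-translate ⇔-∘ P⇔∈ (y ⊖ x)
  where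
  ∈-translate : ∀ {y} → y ⊖ x ∈ xs ⇔ y ∈ map (x ⊕_) xs
  ∈-translate {y} = mk⇔
    (λ y⊖x∈ → subst (_∈ map (x ⊕_) xs) (x⊕[y⊖x]≡y x y) (∈-map⁺ (x ⊕_) y⊖x∈))
    (λ y∈ → let w , w∈ , y≡x⊕w = ∈-map⁻ (x ⊕_) y∈
            in subst (_∈ xs) (sym (trans (cong (_⊖ x) y≡x⊕w) (x⊕y⊖x≡y x w))) w∈)

enumerated⇒HasSize : ∀ {P : Point → Set} xs → (∀ y → P y ⇔ y ∈ xs) → ∃[ n ] HasSize P n
enumerated⇒HasSize xs P⇔∈ =
  length (deduplicate _≟ᵖ_ xs) ,
  deduplicate _≟ᵖ_ xs , refl , deduplicate-! _≟ᵖ_ xs , λ y → deduplicate-∈⇔ _≟ᵖ_ ⇔-∘ P⇔∈ y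

Distinct : {m : ℕ} → Fin m × Fin m → Set
Distinct (i , j) = i ≢ j

distinct? : {m : ℕ} (p : Fin m × Fin m) → Dec (Distinct p)
distinct? (i , j) = ¬? (i F.≟ j)

distinctPairs : (m : ℕ) → List (Fin m × Fin m)
distinctPairs m = filter distinct? (cartesianProduct (allFin m) (allFin m))

∈-distinctPairs⁺ : ∀ {m} {p : Fin m × Fin m} → Distinct p → p ∈ distinctPairs m
∈-distinctPairs⁺ {p = i , j} =
  ∈-filter⁺ distinct? (∈-cartesianProduct⁺ (∈-allFin i) (∈-allFin j))

∈-distinctPairs⁻ : ∀ {m} {p : Fin m × Fin m} → p ∈ distinctPairs m → Distinct p
∈-distinctPairs⁻ {m} = proj₂ ∘ ∈-filter⁻ distinct? {xs = cartesianProduct (allFin m) (allFin m)}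

module _ {m : ℕ} (v : Fin m → Point) where

  DD⇒injective : IsDD v → Injective _≡_ _≡_ v
  DD⇒injective dd {i} {j} vi≡vj with i F.≟ j
  ... | yes i≡j = i≡j
  ... | no i≢j = proj₁ (dd i j j i i≢j (i≢j ∘ sym) (cong₂ _⊖_ vi≡vj (sym vi≡vj)))

  hop⇒difference : ∀ {A C} → OneHop v A C → ∃₂ λ i j → i ≢ j × C ≡ A ⊕ (v i ⊖ v j)
  hop⇒difference (A≢C , u , i , j , refl , refl) =
    j , i , (λ j≡i → A≢C (cong (λ l → u ⊕ v l) (sym j≡i))) , sym (begin
      (u ⊕ v i) ⊕ (v j ⊖ v i)   ≡⟨ ⊕-assoc u (v i) (v j ⊖ v i) ⟩
      u ⊕ (v i ⊕ (v j ⊖ v i))   ≡⟨ cong (u ⊕_) (x⊕[y⊖x]≡y (v i) (v j)) ⟩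
      u ⊕ v j                   ∎)

  difference⇒hop : Injective _≡_ _≡_ v → ∀ A {i j} → i ≢ j → OneHop v A (A ⊕ (v i ⊖ v j))
  difference⇒hop inj A {i} {j} i≢j =
    A≢ , A ⊖ v j , j , i , sym ([x⊖y]⊕y≡x A (v j)) , sym ([x⊖y]⊕z≡x⊕[z⊖y] A (v j) (v i))
    where
    A≢ : A ≢ A ⊕ (v i ⊖ v j)
    A≢ eq = i≢j (inj (x⊖y≡0ᵖ⇒x≡y (v i) (v j) difference≡0ᵖ))
      where
      difference≡0ᵖ : v i ⊖ v j ≡ 0ᵖ
      difference≡0ᵖ = ⊕-cancelˡ A (trans (sym eq) (sym (⊕-identityʳ A)))

  path⇒diffSum : ∀ {ℓ A B} → Path v ℓ A B →
    ∃[ ps ] (length ps ≡ ℓ × All Distinct ps × B ≡ A ⊕ diffSum v ps)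
  path⇒diffSum {A = A} here = [] , refl , [] , sym (⊕-identityʳ A)
  path⇒diffSum {A = A} (step hop p)
    with i , j , i≢j , refl ← hop⇒difference hop
       | ps , refl , distinct , refl ← path⇒diffSum p
    = (i , j) ∷ ps , refl , i≢j ∷ distinct , ⊕-assoc A (v i ⊖ v j) (diffSum v ps)

  diffSum⇒path : Injective _≡_ _≡_ v → ∀ A ps → All Distinct ps →
    Path v (length ps) A (A ⊕ diffSum v ps)
  diffSum⇒path inj A [] [] = subst (Path v 0 A) (sym (⊕-identityʳ A)) here
  diffSum⇒path inj A ((i , j) ∷ ps) (i≢j ∷ distinct) =
    step (difference⇒hop inj A i≢j)
         (subst (Path v (length ps) _) (⊕-assoc A (v i ⊖ v j) (diffSum v ps))
                (diffSum⇒path inj (A ⊕ (v i ⊖ v j)) ps distinct))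

  covered⇔InCk : Injective _≡_ _≡_ v → ∀ k x y → Covered v k x y ⇔ InCk v k (y ⊖ x)
  covered⇔InCk inj k x y = mk⇔ covered⇒InCk InCk⇒covered
    where
    covered⇒InCk : Covered v k x y → InCk v k (y ⊖ x)
    covered⇒InCk (y≢x , ℓ , _ , ℓ≤k , p) with ps , refl , distinct , refl ← path⇒diffSum p =
      y≢x ∘ x⊖y≡0ᵖ⇒x≡y _ x , ps , ℓ≤k , distinct , x⊕y⊖x≡y x (diffSum v ps)

    InCk⇒covered : InCk v k (y ⊖ x) → Covered v k x y
    InCk⇒covered (w≢0 , [] , _ , _ , w≡0) = ⊥-elim (w≢0 w≡0)
    InCk⇒covered (w≢0 , ps@(_ ∷ _) , len≤k , distinct , w≡sum) =
      (λ y≡x → w≢0 (trans (cong (_⊖ x) y≡x) (x⊖x≡0ᵖ x))) ,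
      length ps , s≤s z≤n , len≤k ,
      subst (Path v (length ps) x) reaches-y (diffSum⇒path inj x ps distinct)
      where
      reaches-y : x ⊕ diffSum v ps ≡ y
      reaches-y = trans (cong (x ⊕_) (sym w≡sum)) (x⊕[y⊖x]≡y x y)

  addDifference : Fin m × Fin m → Point → Point
  addDifference (i , j) s = (v i ⊖ v j) ⊕ s

  sums : ℕ → List Point
  sums zero    = 0ᵖ ∷ []
  sums (suc k) = 0ᵖ ∷ cartesianProductWith addDifference (distinctPairs m) (sums k)

  ∈-sums⁺ : ∀ k ps → length ps ≤ k → All Distinct ps → diffSum v ps ∈ sums k
  ∈-sums⁺ zero    []       _         _                  = here refl
  ∈-sums⁺ (suc k) []       _         _                  = here refl
  ∈-sums⁺ (suc k) (p ∷ ps) (s≤s len) (p-distinct ∷ distinct) =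
    there (∈-cartesianProductWith⁺ addDifference
             (∈-distinctPairs⁺ p-distinct) (∈-sums⁺ k ps len distinct))

  ∈-sums⁻ : ∀ k {w} → w ∈ sums k → ∃[ ps ] (length ps ≤ k × All Distinct ps × w ≡ diffSum v ps)
  ∈-sums⁻ zero    (here refl) = [] , z≤n , [] , refl
  ∈-sums⁻ (suc k) (here refl) = [] , z≤n , [] , refl
  ∈-sums⁻ (suc k) (there w∈)
    with p , s , p∈ , s∈ , refl ← ∈-cartesianProductWith⁻ addDifference (distinctPairs m) (sums k) w∈
    with ps , len , distinct , refl ← ∈-sums⁻ k s∈
    = p ∷ ps , s≤s len , ∈-distinctPairs⁻ p∈ ∷ distinct , refl

  InCk-hasSize : ∀ k → ∃[ n ] HasSize (InCk v k) n
  InCk-hasSize k = enumerated⇒HasSize (filter nonZero? (sums k)) λ w → mk⇔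
    (λ (w≢0 , ps , len , distinct , w≡sum) →
       ∈-filter⁺ nonZero? (subst (_∈ sums k) (sym w≡sum) (∈-sums⁺ k ps len distinct)) w≢0)
    (λ w∈ → let w∈sums , w≢0 = ∈-filter⁻ nonZero? {xs = sums k} w∈
            in w≢0 , ∈-sums⁻ k w∈sums)
    where
    nonZero? : (w : Point) → Dec (w ≢ 0ᵖ)
    nonZero? w = ¬? (w ≟ᵖ 0ᵖ)

theorem5 : (m : ℕ) (v : Fin m → Point) → IsDD v → (k : ℕ) → 1 ≤ k → (x : Point) →
    ∃[ n ] (HasSize (Covered v k x) n × HasSize (InCk v k) n)
theorem5 m v dd k _ x =
  let n , size = InCk-hasSize v k
  in n , HasSize-resp-⇔ (covered⇔InCk v (DD⇒injective v dd) k x) (HasSize-translate x size)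
       , size
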